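{- For every $\mathbf{k}=(k_1,\ldots,k_r;k_\infty)$ with $r\ge0$ and $k_1,\ldots,k_r,k_\infty\in\mathbb{N}$, $$\mathrm{Li}^-_{k_1}\cdots\mathrm{Li}^-_{k_r}\,\mathrm{Li}^-_{k_\infty}=\mathrm{Li}^-_{\pi(M^{(\mathbf{k})}x_1)} .$$
   Context: $\mathbb{N}$ is the set of non-negative integers. For $\mathbf{s}=(s_1,\ldots,s_r)\in\mathbb{N}^r$ put $\mathrm{Li}^-_{\mathbf{s}}(z):=\sum_{n_1>\cdots>n_r>0}n_1^{s_1}\cdots n_r^{s_r}z^{n_1}$ for $|z|<1$ (empty index gives $1$); each is a rational function in $\mathbb{C}[z,(1-z)^{ -1}]$, and products are products of these functions; $\mathrm{Li}^-_k$ denotes the depth-one function $\mathrm{Li}^-_{(k)}$. Let $\mathbb{C}\langle Y\rangle$ be the free associative $\mathbb{C}$-algebra on $Y=\{y_0,y_1,\ldots\}$, and let $\mathrm{Li}^-_\bullet:\mathbb{C}\langle Y\rangle\to\mathbb{C}[z,(1-z)^{ -1}]$ be the $\mathbb{C}$-linear map sending the word $y_{s_1}\cdots y_{s_r}$ to $\mathrm{Li}^-_{(s_1,\ldots,s_r)}$ (empty word to $1$). Let $\mathbb{C}\langle x_0,x_1\rangle$ be the free associative algebra on $x_0,x_1$, and $\pi:\mathbb{C}\langle x_0,x_1\rangle x_1\to\mathbb{C}\langle Y\rangle$ the $\mathbb{C}$-linear isomorphism from the span of words ending in $x_1$ given by $x_0^{s_1}x_1x_0^{s_2}x_1\cdots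 x_0^{s_r}x_1\mapsto y_{s_1}y_{s_2}\cdots y_{s_r}$. Define $x_1^{(0)}:=x_1$, $x_1^{(m)}:=x_0x_1^{(m-1)}-x_1^{(m-1)}x_0$ for $m>0$, and the Magnus polynomial $M^{(k_1,\ldots,k_r;k_\infty)}:=x_1^{(k_1)}\cdots x_1^{(k_r)}x_0^{k_\infty}$. -}

module Defs where

open import Data.Nat as ℕ using (ℕ; zero; suc; _^_)
open import Data.Integer as ℤ using (ℤ; +_; -_)
open import Data.List using (List; []; _∷_; _++_; map; foldr; concatMap; replicate; [_])
open import Data.Product using (_×_; _,_)

-- Power series with integer coefficients: f n = coefficient of z^n.
-- (Every function in ℂ[z,(1-z)^{-1}] considered here is given by its
--  Taylor expansion at 0, valid on |z|<1; products of functions are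
--  Cauchy products of series.)

Series : Set
Series = ℕ → ℤ

sumBelow : ℕ → (ℕ → ℤ) → ℤ
sumBelow zero    f = + 0
sumBelow (suc n) f = sumBelow n f ℤ.+ f n

sumBelowℕ : ℕ → (ℕ → ℕ) → ℕ
sumBelowℕ zero    f = 0
sumBelowℕ (suc n) f = sumBelowℕ n f ℕ.+ f n

_⋆_ : Series → Series → Series
(f ⋆ g) n = sumBelow (suc n) (λ i → f i ℤ.* g (n ℕ.∸ i))

oneS : Series
oneS zero    = + 1
oneS (suc n) = + 0

-- Coefficients of Li^-_s(z) = Σ_{n1>…>nr>0} n1^{s1}⋯nr^{sr} z^{n1}.
-- liCoef s n = Σ_{n = n1 > n2 > … > nr > 0} n1^{s1}⋯nr^{sr}
-- (empty index: the constant 1).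

liCoef : List ℕ → ℕ → ℕ
liCoef []      zero    = 1
liCoef []      (suc n) = 0
liCoef (s ∷ r) zero    = 0
liCoef (s ∷ r) (suc n) = (suc n) ^ s ℕ.* sumBelowℕ (suc n) (liCoef r)

Li⁻ : List ℕ → Series
Li⁻ s n = + liCoef s n

-- Noncommutative polynomials ℤ⟨x0,x1⟩ as formal ℤ-linear combinations
-- of words.

data X : Set where
  x0 x1 : X

Word : Set
Word = List X

Poly : Set
Poly = List (ℤ × Word)

wordP : Word → Poly
wordP w = [ (+ 1 , w) ]

_⊕_ : Poly → Poly → Poly
P ⊕ Q = P ++ Q

negP : Poly → Poly
negP = map (λ { (c , w) → (- c , w) })

_⊗_ : Poly → Poly → Poly
P ⊗ Q = concatMap (λ { (c , v) → map (λ { (d , w) → (c ℤ.* d , v ++ w) }) Q }) P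

x1⁽_⁾ : ℕ → Poly
x1⁽ zero ⁾  = wordP (x1 ∷ [])
x1⁽ suc m ⁾ = (wordP (x0 ∷ []) ⊗ x1⁽ m ⁾) ⊕ negP (x1⁽ m ⁾ ⊗ wordP (x0 ∷ []))

Magnus : List ℕ → ℕ → Poly
Magnus ks k∞ = foldr (λ k P → x1⁽ k ⁾ ⊗ P) (wordP (replicate k∞ x0)) ks

-- π on words ending in x1.  πx1 w = π(w x1), which is total on words w:
-- x0^{s1} x1 ⋯ x0^{sr} x1 ↦ y_{s1} ⋯ y_{sr}, indices stored as List ℕ.

πaux : ℕ → Word → List ℕ
πaux c []       = c ∷ []
πaux c (x0 ∷ w) = πaux (suc c) w
πaux c (x1 ∷ w) = c ∷ πaux 0 w

π·x1 : Word → List ℕ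
π·x1 w = πaux 0 w

Li⁻π·x1 : Poly → Series
Li⁻π·x1 []            n = + 0
Li⁻π·x1 ((c , w) ∷ P) n = c ℤ.* Li⁻ (π·x1 w) n ℤ.+ Li⁻π·x1 P n

prodLi : List ℕ → ℕ → Series
prodLi ks k∞ = foldr (λ k S → Li⁻ (k ∷ []) ⋆ S) (Li⁻ (k∞ ∷ [])) ks

{-# OPTIONS --safe #-}
-- Reading x0 as the Euler operator θ = z d/dz and x1 as multiplication by
-- Li⁻₀ = z/(1-z) makes ℤ⟨x0,x1⟩ act on power series, and Li⁻_{π(w x1)} is the
-- image of Li⁻₀ under the word w; hence Li⁻_{π(P Q x1)} = P · Li⁻_{π(Q x1)}.
-- As θ is a derivation of the Cauchy product and θ Li⁻_k = Li⁻_{k+1}, the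
-- commutator x1^{(k+1)} = [x0, x1^{(k)}] acts as multiplication by θ Li⁻_k,
-- so x1^{(k)} acts as multiplication by Li⁻_k.  Peeling off the factors of
-- M^{(k)} one at a time reduces the theorem to Li⁻_{π(x0^k x1)} = Li⁻_k.

module Submission where

open import Defs
open import Data.Nat using (ℕ)
open import Data.List using (List)
open import Relation.Binary.PropositionalEquality using (_≡_)

open import Data.Nat as ℕ using (zero; suc; _∸_; _<_; s≤s)
import Data.Nat.Properties as ℕ
open import Data.Integer using (ℤ; +_; -_; _+_; _*_)
import Data.Integer.Properties as ℤ
open import Data.Integer.Tactic.RingSolver using (solve-∀)
open import Data.List using ([]; _∷_; _++_; map; replicate)
open import Data.Product using (_,_)
open import Function using (id; _∘_)
open import Relation.Binary.PropositionalEquality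
  using (_≗_; refl; sym; trans; cong; cong₂; module ≡-Reasoning)
open ≡-Reasoning

sumBelow-cong : ∀ n {f g : ℕ → ℤ} → (∀ {i} → i < n → f i ≡ g i) →
                sumBelow n f ≡ sumBelow n g
sumBelow-cong zero    f≡g = refl
sumBelow-cong (suc n) f≡g =
  cong₂ _+_ (sumBelow-cong n (f≡g ∘ ℕ.m<n⇒m<1+n)) (f≡g ℕ.≤-refl)

sumBelow-distrib-+ : ∀ n (f g : ℕ → ℤ) →
                     sumBelow n (λ i → f i + g i) ≡ sumBelow n f + sumBelow n g
sumBelow-distrib-+ zero    f g = refl
sumBelow-distrib-+ (suc n) f g = begin
  sumBelow n (λ i → f i + g i) + (f n + g n)
    ≡⟨ cong (_+ (f n + g n)) (sumBelow-distrib-+ n f g) ⟩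
  sumBelow n f + sumBelow n g + (f n + g n)
    ≡⟨ interchange (sumBelow n f) (sumBelow n g) (f n) (g n) ⟩
  sumBelow n f + f n + (sumBelow n g + g n) ∎
  where
  interchange : ∀ a b c d → a + b + (c + d) ≡ a + c + (b + d)
  interchange = solve-∀

*-distribˡ-sumBelow : ∀ n c (f : ℕ → ℤ) →
                      c * sumBelow n f ≡ sumBelow n (λ i → c * f i)
*-distribˡ-sumBelow zero    c f = ℤ.*-zeroʳ c
*-distribˡ-sumBelow (suc n) c f =
  trans (ℤ.*-distribˡ-+ c (sumBelow n f) (f n))
        (cong (_+ c * f n) (*-distribˡ-sumBelow n c f))

sumBelow-suc : ∀ n (f : ℕ → ℤ) →
               sumBelow (suc n) f ≡ f 0 + sumBelow n (f ∘ suc)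
sumBelow-suc zero    f = trans (ℤ.+-identityˡ (f 0)) (sym (ℤ.+-identityʳ (f 0)))
sumBelow-suc (suc n) f =
  trans (cong (_+ f (suc n)) (sumBelow-suc n f)) (ℤ.+-assoc (f 0) _ _)

sumBelow-reverse : ∀ n (f : ℕ → ℤ) →
                   sumBelow (suc n) (λ i → f (n ∸ i)) ≡ sumBelow (suc n) f
sumBelow-reverse zero    f = refl
sumBelow-reverse (suc n) f = begin
  sumBelow (suc (suc n)) (λ i → f (suc n ∸ i))
    ≡⟨ sumBelow-suc (suc n) (λ i → f (suc n ∸ i)) ⟩
  f (suc n) + sumBelow (suc n) (λ i → f (n ∸ i))
    ≡⟨ cong (λ s → f (suc n) + s) (sumBelow-reverse n f) ⟩
  f (suc n) + sumBelow (suc n) f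
    ≡⟨ ℤ.+-comm (f (suc n)) _ ⟩
  sumBelow (suc (suc n)) f ∎

pos-sumBelowℕ : ∀ n (f : ℕ → ℕ) → + sumBelowℕ n f ≡ sumBelow n (λ i → + f i)
pos-sumBelowℕ zero    f = refl
pos-sumBelowℕ (suc n) f =
  trans (ℤ.pos-+ (sumBelowℕ n f) (f n)) (cong (_+ + f n) (pos-sumBelowℕ n f))

infixl 6 _+ˢ_
infixr 7 _·ˢ_
infix  8 -ˢ_

0ˢ : Series
0ˢ _ = + 0

_+ˢ_ : Series → Series → Series
(f +ˢ g) n = f n + g n

_·ˢ_ : ℤ → Series → Series
(c ·ˢ f) n = c * f n

-ˢ_ : Series → Series
(-ˢ f) n = - f n

θ : Series → Series
θ f n = + n * f n

⋆-cong : ∀ {f f′ g g′} → f ≗ f′ → g ≗ g′ → f ⋆ g ≗ f′ ⋆ g′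
⋆-cong f≗f′ g≗g′ n =
  sumBelow-cong (suc n) λ {i} _ → cong₂ _*_ (f≗f′ i) (g≗g′ (n ∸ i))

⋆-distribˡ-+ˢ : ∀ f g h → f ⋆ (g +ˢ h) ≗ f ⋆ g +ˢ f ⋆ h
⋆-distribˡ-+ˢ f g h n =
  trans (sumBelow-cong (suc n) λ {i} _ → ℤ.*-distribˡ-+ (f i) (g (n ∸ i)) (h (n ∸ i)))
        (sumBelow-distrib-+ (suc n) _ _)

⋆-·ˢ : ∀ f c g → f ⋆ (c ·ˢ g) ≗ c ·ˢ (f ⋆ g)
⋆-·ˢ f c g n =
  trans (sumBelow-cong (suc n) λ {i} _ → commute (f i) c (g (n ∸ i)))
        (sym (*-distribˡ-sumBelow (suc n) c _))
  where
  commute : ∀ a c b → a * (c * b) ≡ c * (a * b)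
  commute = solve-∀

-- Leibniz rule: in the i-th term of the Cauchy sum the weight n splits as i + (n ∸ i).
θ-⋆ : ∀ f g → θ (f ⋆ g) ≗ θ f ⋆ g +ˢ f ⋆ θ g
θ-⋆ f g n = begin
  + n * sumBelow (suc n) (λ i → f i * g (n ∸ i))
    ≡⟨ *-distribˡ-sumBelow (suc n) (+ n) _ ⟩
  sumBelow (suc n) (λ i → + n * (f i * g (n ∸ i)))
    ≡⟨ sumBelow-cong (suc n) split ⟩
  sumBelow (suc n) (λ i → + i * f i * g (n ∸ i) + f i * (+ (n ∸ i) * g (n ∸ i)))
    ≡⟨ sumBelow-distrib-+ (suc n) _ _ ⟩
  (θ f ⋆ g +ˢ f ⋆ θ g) n ∎
  where
  distrib : ∀ a b x y → (a + b) * (x * y) ≡ a * x * y + x * (b * y)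
  distrib = solve-∀
  split : ∀ {i} → i < suc n →
          + n * (f i * g (n ∸ i)) ≡ + i * f i * g (n ∸ i) + f i * (+ (n ∸ i) * g (n ∸ i))
  split {i} (s≤s i≤n) = begin
    + n * (f i * g (n ∸ i))
      ≡⟨ cong (λ m → + m * (f i * g (n ∸ i))) (sym (ℕ.m+[n∸m]≡n i≤n)) ⟩
    + (i ℕ.+ (n ∸ i)) * (f i * g (n ∸ i))
      ≡⟨ cong (_* (f i * g (n ∸ i))) (ℤ.pos-+ i (n ∸ i)) ⟩
    (+ i + + (n ∸ i)) * (f i * g (n ∸ i))
      ≡⟨ distrib (+ i) (+ (n ∸ i)) (f i) (g (n ∸ i)) ⟩
    + i * f i * g (n ∸ i) + f i * (+ (n ∸ i) * g (n ∸ i)) ∎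

record IsLinear (T : Series → Series) : Set where
  field
    cong-≗ : ∀ {f g} → f ≗ g → T f ≗ T g
    +-homo : ∀ f g → T (f +ˢ g) ≗ T f +ˢ T g
    ·-homo : ∀ c f → T (c ·ˢ f) ≗ c ·ˢ T f

  0-homo : T 0ˢ ≗ 0ˢ
  0-homo n = trans (·-homo (+ 0) 0ˢ n) (ℤ.*-zeroˡ (T 0ˢ n))

id-isLinear : IsLinear id
id-isLinear = record
  { cong-≗ = id
  ; +-homo = λ _ _ _ → refl
  ; ·-homo = λ _ _ _ → refl
  }

∘-isLinear : ∀ {S T} → IsLinear S → IsLinear T → IsLinear (S ∘ T)
∘-isLinear {S} {T} S-lin T-lin = record
  { cong-≗ = S.cong-≗ ∘ T.cong-≗
  ; +-homo = λ f g n → trans (S.cong-≗ (T.+-homo f g) n) (S.+-homo (T f) (T g) n)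
  ; ·-homo = λ c f n → trans (S.cong-≗ (T.·-homo c f) n) (S.·-homo c (T f) n)
  }
  where
  module S = IsLinear S-lin
  module T = IsLinear T-lin

θ-isLinear : IsLinear θ
θ-isLinear = record
  { cong-≗ = λ f≗g n → cong (+ n *_) (f≗g n)
  ; +-homo = λ f g n → ℤ.*-distribˡ-+ (+ n) (f n) (g n)
  ; ·-homo = λ c f n → commute (+ n) c (f n)
  }
  where
  commute : ∀ a c b → a * (c * b) ≡ c * (a * b)
  commute = solve-∀

⋆-isLinear : ∀ f → IsLinear (f ⋆_)
⋆-isLinear f = record
  { cong-≗ = ⋆-cong {f} (λ _ → refl)
  ; +-homo = ⋆-distribˡ-+ˢ f
  ; ·-homo = ⋆-·ˢ f
  }

Li⁻-suc : ∀ k s → Li⁻ (suc k ∷ s) ≗ θ (Li⁻ (k ∷ s))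
Li⁻-suc k s zero    = refl
Li⁻-suc k s (suc m) =
  trans (cong +_ (ℕ.*-assoc (suc m) (suc m ℕ.^ k) _)) (ℤ.pos-* (suc m) _)

Li⁻-πaux-suc : ∀ c w → Li⁻ (πaux (suc c) w) ≗ θ (Li⁻ (πaux c w))
Li⁻-πaux-suc c []       = Li⁻-suc c []
Li⁻-πaux-suc c (x0 ∷ w) = Li⁻-πaux-suc (suc c) w
Li⁻-πaux-suc c (x1 ∷ w) = Li⁻-suc c (πaux 0 w)

Li⁻₀-suc : ∀ m → Li⁻ (0 ∷ []) (suc m) ≡ + 1
Li⁻₀-suc m = cong +_ (trans (ℕ.+-identityʳ _) (sumBelowℕ-empty m))
  where
  sumBelowℕ-empty : ∀ m → sumBelowℕ (suc m) (liCoef []) ≡ 1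
  sumBelowℕ-empty zero    = refl
  sumBelowℕ-empty (suc m) = trans (ℕ.+-identityʳ _) (sumBelowℕ-empty m)

Li⁻₀-⋆-suc : ∀ f m → (Li⁻ (0 ∷ []) ⋆ f) (suc m) ≡ sumBelow (suc m) f
Li⁻₀-⋆-suc f m = begin
  sumBelow (suc (suc m)) (λ i → Li⁻ (0 ∷ []) i * f (suc m ∸ i))
    ≡⟨ sumBelow-suc (suc m) _ ⟩
  + 0 + sumBelow (suc m) (λ i → Li⁻ (0 ∷ []) (suc i) * f (m ∸ i))
    ≡⟨ ℤ.+-identityˡ _ ⟩
  sumBelow (suc m) (λ i → Li⁻ (0 ∷ []) (suc i) * f (m ∸ i))
    ≡⟨ sumBelow-cong (suc m) (λ {i} _ → trans (cong (_* f (m ∸ i)) (Li⁻₀-suc i)) (ℤ.*-identityˡ _)) ⟩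
  sumBelow (suc m) (λ i → f (m ∸ i))
    ≡⟨ sumBelow-reverse m f ⟩
  sumBelow (suc m) f ∎

Li⁻-0∷ : ∀ s → Li⁻ (0 ∷ s) ≗ Li⁻ (0 ∷ []) ⋆ Li⁻ s
Li⁻-0∷ s zero    = refl
Li⁻-0∷ s (suc m) = begin
  + (1 ℕ.* sumBelowℕ (suc m) (liCoef s))
    ≡⟨ cong +_ (ℕ.*-identityˡ _) ⟩
  + sumBelowℕ (suc m) (liCoef s)
    ≡⟨ pos-sumBelowℕ (suc m) (liCoef s) ⟩
  sumBelow (suc m) (Li⁻ s)
    ≡⟨ sym (Li⁻₀-⋆-suc (Li⁻ s) m) ⟩
  (Li⁻ (0 ∷ []) ⋆ Li⁻ s) (suc m) ∎

act : X → Series → Series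
act x0 = θ
act x1 = Li⁻ (0 ∷ []) ⋆_

actWord : Word → Series → Series
actWord []      f = f
actWord (x ∷ w) f = act x (actWord w f)

actPoly : Poly → Series → Series
actPoly []            f = 0ˢ
actPoly ((c , w) ∷ P) f = c ·ˢ actWord w f +ˢ actPoly P f

act-isLinear : ∀ x → IsLinear (act x)
act-isLinear x0 = θ-isLinear
act-isLinear x1 = ⋆-isLinear (Li⁻ (0 ∷ []))

actWord-isLinear : ∀ w → IsLinear (actWord w)
actWord-isLinear []      = id-isLinear
actWord-isLinear (x ∷ w) = ∘-isLinear (act-isLinear x) (actWord-isLinear w)

actWord-++ : ∀ v w f → actWord (v ++ w) f ≡ actWord v (actWord w f)
actWord-++ []      w f = refl
actWord-++ (x ∷ v) w f = cong (act x) (actWord-++ v w f)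

actPoly-isLinear : ∀ P → IsLinear (actPoly P)
actPoly-isLinear []            = record
  { cong-≗ = λ _ _ → refl
  ; +-homo = λ _ _ _ → refl
  ; ·-homo = λ c _ _ → sym (ℤ.*-zeroʳ c)
  }
actPoly-isLinear ((c , w) ∷ P) = record
  { cong-≗ = λ f≗g n → cong₂ _+_ (cong (c *_) (W.cong-≗ f≗g n)) (P.cong-≗ f≗g n)
  ; +-homo = λ f g n → begin
      c * actWord w (f +ˢ g) n + actPoly P (f +ˢ g) n
        ≡⟨ cong₂ _+_ (cong (c *_) (W.+-homo f g n)) (P.+-homo f g n) ⟩
      c * (actWord w f n + actWord w g n) + (actPoly P f n + actPoly P g n)
        ≡⟨ distrib c (actWord w f n) (actWord w g n) (actPoly P f n) (actPoly P g n) ⟩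
      c * actWord w f n + actPoly P f n + (c * actWord w g n + actPoly P g n) ∎
  ; ·-homo = λ d f n → begin
      c * actWord w (d ·ˢ f) n + actPoly P (d ·ˢ f) n
        ≡⟨ cong₂ _+_ (cong (c *_) (W.·-homo d f n)) (P.·-homo d f n) ⟩
      c * (d * actWord w f n) + d * actPoly P f n
        ≡⟨ commute c d (actWord w f n) (actPoly P f n) ⟩
      d * (c * actWord w f n + actPoly P f n) ∎
  }
  where
  module W = IsLinear (actWord-isLinear w)
  module P = IsLinear (actPoly-isLinear P)
  distrib : ∀ c a b p q → c * (a + b) + (p + q) ≡ c * a + p + (c * b + q)
  distrib = solve-∀
  commute : ∀ c d a p → c * (d * a) + d * p ≡ d * (c * a + p)
  commute = solve-∀

actPoly-++ : ∀ P Q f → actPoly (P ++ Q) f ≗ actPoly P f +ˢ actPoly Q f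
actPoly-++ []            Q f n = sym (ℤ.+-identityˡ _)
actPoly-++ ((c , w) ∷ P) Q f n =
  trans (cong (λ r → c * actWord w f n + r) (actPoly-++ P Q f n))
        (sym (ℤ.+-assoc (c * actWord w f n) _ _))

actPoly-negP : ∀ P f → actPoly (negP P) f ≗ -ˢ actPoly P f
actPoly-negP []            f n = refl
actPoly-negP ((c , w) ∷ P) f n =
  trans (cong₂ _+_ (sym (ℤ.neg-distribˡ-* c (actWord w f n))) (actPoly-negP P f n))
        (sym (ℤ.neg-distrib-+ (c * actWord w f n) (actPoly P f n)))

actPoly-monomial-⊗ : ∀ c v Q f →
  actPoly (map (λ { (d , w) → (c * d , v ++ w) }) Q) f ≗ c ·ˢ actWord v (actPoly Q f)
actPoly-monomial-⊗ c v []            f n =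
  sym (trans (cong (c *_) (IsLinear.0-homo (actWord-isLinear v) n)) (ℤ.*-zeroʳ c))
actPoly-monomial-⊗ c v ((d , w) ∷ Q) f n = begin
  c * d * actWord (v ++ w) f n + actPoly (map _ Q) f n
    ≡⟨ cong₂ (λ a r → c * d * a + r) (cong (λ g → g n) (actWord-++ v w f))
                                     (actPoly-monomial-⊗ c v Q f n) ⟩
  c * d * actWord v (actWord w f) n + c * actWord v (actPoly Q f) n
    ≡⟨ distrib c d (actWord v (actWord w f) n) (actWord v (actPoly Q f) n) ⟩
  c * (d * actWord v (actWord w f) n + actWord v (actPoly Q f) n)
    ≡⟨ cong (c *_) (sym (trans (V.+-homo (d ·ˢ actWord w f) (actPoly Q f) n)
                               (cong (_+ actWord v (actPoly Q f) n) (V.·-homo d (actWord w f) n)))) ⟩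
  c * actWord v (d ·ˢ actWord w f +ˢ actPoly Q f) n ∎
  where
  module V = IsLinear (actWord-isLinear v)
  distrib : ∀ c d a b → c * d * a + c * b ≡ c * (d * a + b)
  distrib = solve-∀

actPoly-⊗ : ∀ P Q f → actPoly (P ⊗ Q) f ≗ actPoly P (actPoly Q f)
actPoly-⊗ []            Q f n = refl
actPoly-⊗ ((c , v) ∷ P) Q f n =
  trans (actPoly-++ (map (λ { (d , w) → (c * d , v ++ w) }) Q) (P ⊗ Q) f n)
        (cong₂ _+_ (actPoly-monomial-⊗ c v Q f n) (actPoly-⊗ P Q f n))

actPoly-x0 : ∀ f → actPoly (wordP (x0 ∷ [])) f ≗ θ f
actPoly-x0 f n = trans (ℤ.+-identityʳ _) (ℤ.*-identityˡ (θ f n))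

actPoly-x1⁽⁾ : ∀ k f → actPoly (x1⁽ k ⁾) f ≗ Li⁻ (k ∷ []) ⋆ f
actPoly-x1⁽⁾ zero    f n = trans (ℤ.+-identityʳ _) (ℤ.*-identityˡ _)
actPoly-x1⁽⁾ (suc k) f n = begin
  actPoly ((X0 ⊗ x1⁽ k ⁾) ++ negP (x1⁽ k ⁾ ⊗ X0)) f n
    ≡⟨ actPoly-++ (X0 ⊗ x1⁽ k ⁾) (negP (x1⁽ k ⁾ ⊗ X0)) f n ⟩
  actPoly (X0 ⊗ x1⁽ k ⁾) f n + actPoly (negP (x1⁽ k ⁾ ⊗ X0)) f n
    ≡⟨ cong₂ _+_ (actPoly-⊗ X0 (x1⁽ k ⁾) f n) (actPoly-negP (x1⁽ k ⁾ ⊗ X0) f n) ⟩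
  actPoly X0 (actPoly (x1⁽ k ⁾) f) n + - actPoly (x1⁽ k ⁾ ⊗ X0) f n
    ≡⟨ cong₂ (λ a b → a + - b) (actPoly-x0 (actPoly (x1⁽ k ⁾) f) n) (actPoly-⊗ (x1⁽ k ⁾) X0 f n) ⟩
  θ (actPoly (x1⁽ k ⁾) f) n + - actPoly (x1⁽ k ⁾) (actPoly X0 f) n
    ≡⟨ cong₂ (λ a b → a + - b) (IsLinear.cong-≗ θ-isLinear (actPoly-x1⁽⁾ k f) n)
                               (trans (IsLinear.cong-≗ (actPoly-isLinear (x1⁽ k ⁾)) (actPoly-x0 f) n)
                                      (actPoly-x1⁽⁾ k (θ f) n)) ⟩
  θ (Li⁻ (k ∷ []) ⋆ f) n + - (Li⁻ (k ∷ []) ⋆ θ f) n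
    ≡⟨ cong (_+ - (Li⁻ (k ∷ []) ⋆ θ f) n) (θ-⋆ (Li⁻ (k ∷ [])) f n) ⟩
  (θ (Li⁻ (k ∷ [])) ⋆ f) n + (Li⁻ (k ∷ []) ⋆ θ f) n + - (Li⁻ (k ∷ []) ⋆ θ f) n
    ≡⟨ cancel ((θ (Li⁻ (k ∷ [])) ⋆ f) n) ((Li⁻ (k ∷ []) ⋆ θ f) n) ⟩
  (θ (Li⁻ (k ∷ [])) ⋆ f) n
    ≡⟨ ⋆-cong {g = f} (λ m → sym (Li⁻-suc k [] m)) (λ _ → refl) n ⟩
  (Li⁻ (suc k ∷ []) ⋆ f) n ∎
  where
  X0 = wordP (x0 ∷ [])
  cancel : ∀ a b → a + b + - b ≡ a
  cancel = solve-∀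

Li⁻-π·x1-∷ : ∀ x w → Li⁻ (π·x1 (x ∷ w)) ≗ act x (Li⁻ (π·x1 w))
Li⁻-π·x1-∷ x0 w = Li⁻-πaux-suc 0 w
Li⁻-π·x1-∷ x1 w = Li⁻-0∷ (π·x1 w)

Li⁻-π·x1 : ∀ w → Li⁻ (π·x1 w) ≗ actWord w (Li⁻ (0 ∷ []))
Li⁻-π·x1 []      n = refl
Li⁻-π·x1 (x ∷ w) n =
  trans (Li⁻-π·x1-∷ x w n) (IsLinear.cong-≗ (act-isLinear x) (Li⁻-π·x1 w) n)

Li⁻π·x1≗actPoly : ∀ P → Li⁻π·x1 P ≗ actPoly P (Li⁻ (0 ∷ []))
Li⁻π·x1≗actPoly []            n = refl
Li⁻π·x1≗actPoly ((c , w) ∷ P) n =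
  cong₂ _+_ (cong (c *_) (Li⁻-π·x1 w n)) (Li⁻π·x1≗actPoly P n)

Li⁻π·x1-⊗ : ∀ P Q → Li⁻π·x1 (P ⊗ Q) ≗ actPoly P (Li⁻π·x1 Q)
Li⁻π·x1-⊗ P Q n = begin
  Li⁻π·x1 (P ⊗ Q) n
    ≡⟨ Li⁻π·x1≗actPoly (P ⊗ Q) n ⟩
  actPoly (P ⊗ Q) (Li⁻ (0 ∷ [])) n
    ≡⟨ actPoly-⊗ P Q (Li⁻ (0 ∷ [])) n ⟩
  actPoly P (actPoly Q (Li⁻ (0 ∷ []))) n
    ≡⟨ IsLinear.cong-≗ (actPoly-isLinear P) (sym ∘ Li⁻π·x1≗actPoly Q) n ⟩
  actPoly P (Li⁻π·x1 Q) n ∎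

πaux-replicate-x0 : ∀ c k → πaux c (replicate k x0) ≡ k ℕ.+ c ∷ []
πaux-replicate-x0 c zero    = refl
πaux-replicate-x0 c (suc k) =
  trans (πaux-replicate-x0 (suc c) k) (cong (_∷ []) (ℕ.+-suc k c))

Li⁻π·x1-replicate-x0 : ∀ k → Li⁻π·x1 (wordP (replicate k x0)) ≗ Li⁻ (k ∷ [])
Li⁻π·x1-replicate-x0 k n = begin
  + 1 * Li⁻ (π·x1 (replicate k x0)) n + + 0
    ≡⟨ trans (ℤ.+-identityʳ _) (ℤ.*-identityˡ _) ⟩
  Li⁻ (π·x1 (replicate k x0)) n
    ≡⟨ cong (λ s → Li⁻ s n) (trans (πaux-replicate-x0 0 k) (cong (_∷ []) (ℕ.+-identityʳ k))) ⟩
  Li⁻ (k ∷ []) n ∎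

theorem4p8 : (ks : List ℕ) (k∞ : ℕ) (n : ℕ) →
    prodLi ks k∞ n ≡ Li⁻π·x1 (Magnus ks k∞) n
theorem4p8 []       k∞ n = sym (Li⁻π·x1-replicate-x0 k∞ n)
theorem4p8 (k ∷ ks) k∞ n = begin
  (Li⁻ (k ∷ []) ⋆ prodLi ks k∞) n
    ≡⟨ ⋆-cong {f = Li⁻ (k ∷ [])} (λ _ → refl) (theorem4p8 ks k∞) n ⟩
  (Li⁻ (k ∷ []) ⋆ Li⁻π·x1 (Magnus ks k∞)) n
    ≡⟨ sym (actPoly-x1⁽⁾ k (Li⁻π·x1 (Magnus ks k∞)) n) ⟩
  actPoly (x1⁽ k ⁾) (Li⁻π·x1 (Magnus ks k∞)) n
    ≡⟨ sym (Li⁻π·x1-⊗ (x1⁽ k ⁾) (Magnus ks k∞) n) ⟩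
  Li⁻π·x1 (x1⁽ k ⁾ ⊗ Magnus ks k∞) n ∎
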